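{- Let $n, r \geq 1$. Then: (i) $\mathcal{S}_{(r,n)}(x) = \binom{r+n}{r}^{ -1} \sum_{k=0}^{n} \binom{r+n}{k} (-1)^{n-k} x^k$; (ii) $\mathcal{S}_{(r,n)}(-1) = (-1)^n \binom{r+n}{r}^{ -1} \sum_{k=0}^{n} \binom{r+n}{k}$; (iii) $(-1)^n \mathcal{S}_{(r,n)}(-1) + (-1)^r \mathcal{S}_{(n,r)}(-1) = 2^{r+n} \binom{r+n}{r}^{ -1} + 1$; (iv) at least one of $\mathcal{S}_{(r,n)}(-1)$, $\mathcal{S}_{(n,r)}(-1)$ is not in $\mathbb{Z}$; in particular $\mathcal{S}_{(n,n)}(-1), \mathcal{S}_{(n+1,n)}(-1), \mathcal{S}_{(n,n+1)}(-1) \notin \mathbb{Z}$.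
   Context: For integers $n, r \geq 0$, $\mathcal{S}_{(r,n)}(x) = \sum_{k=0}^{n} \binom{n}{k} (-1)^k x^{n-k} \binom{r+k}{r}^{ -1} \in \mathbb{Q}[x]$. -}

module Defs where

open import Data.Nat using (ℕ; zero; suc; _∸_) renaming (_+_ to _+ℕ_)
open import Data.Nat.Combinatorics using (_C_)
open import Data.Integer using (ℤ; +_)
open import Data.Rational using (ℚ; _/_; 0ℚ; 1ℚ; _+_; _*_; -_)
open import Data.Product using (∃)
open import Relation.Binary.PropositionalEquality using (_≡_)

ℕ→ℚ : ℕ → ℚ
ℕ→ℚ n = (+ n) / 1

ℤ→ℚ : ℤ → ℚ
ℤ→ℚ z = z / 1

-- multiplicative inverse of a natural number in ℚ
-- (only ever applied to binomial coefficients C(m,r) with r ≤ m, which are ≥ 1;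
--  the value at 0 is an irrelevant convention)
inv : ℕ → ℚ
inv zero    = 0ℚ
inv (suc m) = (+ 1) / suc m

pow : ℚ → ℕ → ℚ
pow x zero    = 1ℚ
pow x (suc k) = x * pow x k

-1ℚ : ℚ
-1ℚ = - 1ℚ

sgn : ℕ → ℚ
sgn k = pow -1ℚ k

sumTo : ℕ → (ℕ → ℚ) → ℚ
sumTo zero    f = f 0
sumTo (suc n) f = sumTo n f + f (suc n)

S : ℕ → ℕ → ℚ → ℚ
S r n x = sumTo n (λ k → ℕ→ℚ (n C k) * sgn k * pow x (n ∸ k) * inv ((r +ℕ k) C r))

IsInt : ℚ → Set
IsInt q = ∃ (λ (z : ℤ) → q ≡ ℤ→ℚ z)

module Submission where

-- Reversing the order of summation and the revision identity C(n,j) C(r+n,r) = C(r+n,k) C(r+j,r)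
-- (n = j + k) give (i). At x = −1 every sign becomes (−1)^n, so S_(r,n)(−1) = (−1)^n A_n / C with
-- C = C(r+n, r) and A_m = Σ_{k ≤ m} C(r+n, k), which is (ii); by the symmetry C(N, k) = C(N, N − k) of the
-- row N = r + n, A_n + A_r = 2^N + C, which is (iii).
-- Hence S_(r,n)(−1) ∈ ℤ iff C ∣ A_n. If C divided both A_n and A_r it would divide 2^N and so be a power
-- of 2; for r, n ≥ 2 this contradicts C > N together with the 2-adic bound 2^e ∣ C(N, k) ⇒ 2^e ≤ N, and
-- for r = 1 (or n = 1) C = N cannot divide A_1 = 1 + N. For r = n the identity reads 2 A_n = 2^N + C, so
-- C ∣ A_n makes the odd number 2 A_n / C − 1 divide 2^N, forcing A_n = C, which is false; for |r − n| = 1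
-- it reads 2 A_n = 2^N, whereas C is divisible by the odd number N > 1.

module BinomialCoefficients where

  open import Data.Nat
  open import Data.Nat.Properties
  open import Data.Nat.Combinatorics using (_C_; nCk≡n!/k![n-k]!; k![n∸k]!∣n!; nCk≡nC[n∸k]; nC1≡n; nCk+nC[k+1]≡[n+1]C[k+1])
  open import Data.Nat.DivMod using (m/n*n≡m)
  open import Data.Nat.Divisibility
  open import Data.Nat.Tactic.RingSolver using (solve-∀)
  open import Relation.Binary.PropositionalEquality
  open import Relation.Nullary using (contradiction)

  nCk*[k!*[n∸k]!]≡n! : ∀ {n k} → k ≤ n → (n C k) * (k ! * (n ∸ k) !) ≡ n !
  nCk*[k!*[n∸k]!]≡n! {n} {k} k≤n = begin
    (n C k) * (k ! * (n ∸ k) !)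
      ≡⟨ cong (_* (k ! * (n ∸ k) !)) (nCk≡n!/k![n-k]! k≤n) ⟩
    (n ! / (k ! * (n ∸ k) !)) {{m*n≢0 _ _ {{k !≢0}} {{(n ∸ k) !≢0}}}} * (k ! * (n ∸ k) !)
      ≡⟨ m/n*n≡m {{m*n≢0 _ _ {{k !≢0}} {{(n ∸ k) !≢0}}}} (k![n∸k]!∣n! k≤n) ⟩
    n ! ∎
    where open ≡-Reasoning

  [m+n]Cm*[m!*n!]≡[m+n]! : ∀ m n → ((m + n) C m) * (m ! * n !) ≡ (m + n) !
  [m+n]Cm*[m!*n!]≡[m+n]! m n =
    subst (λ d → ((m + n) C m) * (m ! * d !) ≡ (m + n) !) (m+n∸m≡n m n) (nCk*[k!*[n∸k]!]≡n! (m≤m+n m n))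

  0<[m+n]Cm : ∀ m n → 0 < (m + n) C m
  0<[m+n]Cm m n with (m + n) C m | [m+n]Cm*[m!*n!]≡[m+n]! m n
  ... | suc _ | _  = z<s
  ... | zero  | eq = contradiction (sym eq) (≢-nonZero⁻¹ _ {{(m + n) !≢0}})

  [m+n]Cm≡[m+n]Cn : ∀ m n → (m + n) C m ≡ (m + n) C n
  [m+n]Cm≡[m+n]Cn m n = trans (nCk≡nC[n∸k] (m≤m+n m n)) (cong ((m + n) C_) (m+n∸m≡n m n))

  [m+n]Cm≡[n+m]Cn : ∀ m n → (m + n) C m ≡ (n + m) C n
  [m+n]Cm≡[n+m]Cn m n = trans ([m+n]Cm≡[m+n]Cn m n) (cong (_C n) (+-comm m n))

  -- Both sides equal (r + j + k)! / (r! j! k!).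
  binomial-revision : ∀ r j k → ((j + k) C j) * ((r + (j + k)) C r) ≡ ((r + (j + k)) C k) * ((r + j) C r)
  binomial-revision r j k = *-cancelʳ-≡ _ _ (j ! * k ! * r !) {{j!k!r!≢0}} (begin
    ((j + k) C j) * (N C r) * (j ! * k ! * r !)  ≡⟨ regroupˡ ((j + k) C j) (N C r) (j !) (k !) (r !) ⟩
    (N C r) * (r ! * (((j + k) C j) * (j ! * k !))) ≡⟨ cong (λ t → (N C r) * (r ! * t)) ([m+n]Cm*[m!*n!]≡[m+n]! j k) ⟩
    (N C r) * (r ! * (j + k) !)                    ≡⟨ [m+n]Cm*[m!*n!]≡[m+n]! r (j + k) ⟩
    N !                                            ≡⟨ [N]Ck*[k!*[r+j]!]≡N! ⟨
    (N C k) * (k ! * (r + j) !)                    ≡⟨ cong (λ t → (N C k) * (k ! * t)) ([m+n]Cm*[m!*n!]≡[m+n]! r j) ⟨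
    (N C k) * (k ! * (((r + j) C r) * (r ! * j !))) ≡⟨ regroupʳ (N C k) ((r + j) C r) (j !) (k !) (r !) ⟩
    (N C k) * ((r + j) C r) * (j ! * k ! * r !)    ∎)
    where
    open ≡-Reasoning
    N = r + (j + k)
    j!k!r!≢0 : NonZero (j ! * k ! * r !)
    j!k!r!≢0 = m*n≢0 _ _ {{m*n≢0 _ _ {{j !≢0}} {{k !≢0}}}} {{r !≢0}}
    [N]Ck*[k!*[r+j]!]≡N! : (N C k) * (k ! * (r + j) !) ≡ N !
    [N]Ck*[k!*[r+j]!]≡N! = subst (λ t → (t C k) * (k ! * (r + j) !) ≡ t !) (rotate k r j) ([m+n]Cm*[m!*n!]≡[m+n]! k (r + j))
      where
      rotate : ∀ k r j → k + (r + j) ≡ r + (j + k)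
      rotate = solve-∀
    regroupˡ : ∀ x y a b c → x * y * (a * b * c) ≡ y * (c * (x * (a * b)))
    regroupˡ = solve-∀
    regroupʳ : ∀ x y a b c → x * (b * (y * (c * a))) ≡ x * y * (a * b * c)
    regroupʳ = solve-∀

  pascal : ∀ a b → (suc a + suc b) C suc a ≡ (a + suc b) C a + (suc a + b) C suc a
  pascal a b = begin
    (suc a + suc b) C suc a                    ≡⟨ nCk+nC[k+1]≡[n+1]C[k+1] (a + suc b) a ⟨
    (a + suc b) C a + (a + suc b) C suc a      ≡⟨ cong (λ t → (a + suc b) C a + t C suc a) (+-suc a b) ⟩
    (a + suc b) C a + (suc a + b) C suc a      ∎
    where open ≡-Reasoning

  m+n<[m+n]Cm : ∀ {m n} → 1 < m → 1 < n → m + n < (m + n) C m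

  m+n≤[m+n]Cm : ∀ {m n} → 0 < m → 0 < n → m + n ≤ (m + n) C m
  m+n≤[m+n]Cm {zero}        ()
  m+n≤[m+n]Cm {suc (suc _)} {zero}        _ ()
  m+n≤[m+n]Cm {suc zero}    {n}           _ _ = ≤-reflexive (sym (nC1≡n (1 + n)))
  m+n≤[m+n]Cm {suc (suc a)} {suc zero}    _ _ =
    ≤-reflexive (sym (trans ([m+n]Cm≡[m+n]Cn (2 + a) 1) (nC1≡n (2 + a + 1))))
  m+n≤[m+n]Cm {suc (suc a)} {suc (suc b)} _ _ = <⇒≤ (m+n<[m+n]Cm (s≤s (s≤s z≤n)) (s≤s (s≤s z≤n)))

  m+n<[m+n]Cm {suc (suc a)} {suc (suc b)} (s≤s (s≤s z≤n)) (s≤s (s≤s z≤n)) = begin-strict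
    2 + a + (2 + b)                                            <⟨ m<m+n _ z<s ⟩
    2 + a + (2 + b) + (2 + (a + b))                            ≡⟨ regroup a b ⟩
    1 + a + (2 + b) + (2 + a + (1 + b))                        ≤⟨ +-mono-≤ (m+n≤[m+n]Cm {suc a} {suc (suc b)} z<s z<s)
                                                                           (m+n≤[m+n]Cm {suc (suc a)} {suc b} z<s z<s) ⟩
    (1 + a + (2 + b)) C (1 + a) + (2 + a + (1 + b)) C (2 + a)  ≡⟨ pascal (suc a) (suc b) ⟨
    (2 + a + (2 + b)) C (2 + a)                                ∎
    where
    open ≤-Reasoning
    regroup : ∀ a b → 2 + a + (2 + b) + (2 + (a + b)) ≡ 1 + a + (2 + b) + (2 + a + (1 + b))
    regroup = solve-∀

  absorption : ∀ a b → suc a * ((suc a + b) C suc a) ≡ suc (a + b) * ((a + b) C a)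
  absorption a b =
    *-cancelʳ-≡ (suc a * ((suc a + b) C suc a)) (suc (a + b) * ((a + b) C a)) (a ! * b !) {{m*n≢0 _ _ {{a !≢0}} {{b !≢0}}}} (begin
    suc a * ((suc a + b) C suc a) * (a ! * b !)   ≡⟨ regroup (suc a) ((suc a + b) C suc a) (a !) (b !) ⟩
    ((suc a + b) C suc a) * (suc a ! * b !)       ≡⟨ [m+n]Cm*[m!*n!]≡[m+n]! (suc a) b ⟩
    suc (a + b) * (a + b) !                       ≡⟨ cong (suc (a + b) *_) ([m+n]Cm*[m!*n!]≡[m+n]! a b) ⟨
    suc (a + b) * (((a + b) C a) * (a ! * b !))   ≡⟨ *-assoc (suc (a + b)) ((a + b) C a) (a ! * b !) ⟨
    suc (a + b) * ((a + b) C a) * (a ! * b !)     ∎)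
    where
    open ≡-Reasoning
    regroup : ∀ s c x y → s * c * (x * y) ≡ c * (s * x * y)
    regroup = solve-∀

  1+2n∣[1+2n]C[1+n] : ∀ n → suc (n * 2) ∣ (suc n + n) C suc n
  1+2n∣[1+2n]C[1+n] n = ∣m+n∣m⇒∣n (subst (suc (n * 2) ∣_) (double n d) 1+2n∣2[1+n]d) (m∣m*n d)
    where
    d = (suc n + n) C suc n
    twice : ∀ n c → suc (n + n) * c ≡ c * suc (n * 2)
    twice = solve-∀
    1+2n∣2[1+n]d : suc (n * 2) ∣ 2 * (suc n * d)
    1+2n∣2[1+n]d = ∣n⇒∣m*n 2 (divides ((n + n) C n) (trans (absorption n n) (twice n ((n + n) C n))))
    double : ∀ n d → 2 * (suc n * d) ≡ suc (n * 2) * d + d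
    double = solve-∀

module TwoAdic where

  open import Data.Nat
  open import Data.Nat.Properties
  open import Data.Nat.DivMod using (_/_; _%_; m≡m%n+[m/n]*n; m%n<n; /-monoˡ-≤)
  open import Data.Nat.Divisibility
  open import Data.Nat.Induction using (<-rec)
  open import Data.Nat.Tactic.RingSolver using (solve-∀)
  open import Data.Product using (∃; ∃₂; _×_; _,_)
  open import Relation.Nullary using (¬_; contradiction)
  open import Relation.Binary.PropositionalEquality
  open import Data.Nat.Combinatorics using (_C_)
  open BinomialCoefficients using ([m+n]Cm*[m!*n!]≡[m+n]!; m+n<[m+n]Cm; 1+2n∣[1+2n]C[1+n])

  Odd : ℕ → Set
  Odd o = ∃ λ t → o ≡ suc (t * 2)

  Odd-* : ∀ {m n} → Odd m → Odd n → Odd (m * n)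
  Odd-* (s , refl) (t , refl) = s + t + s * t * 2 , expand s t
    where
    expand : ∀ s t → suc (s * 2) * suc (t * 2) ≡ suc ((s + t + s * t * 2) * 2)
    expand = solve-∀

  halve : ∀ n → ∃₂ λ i a → i ≤ 1 × n ≡ i + a * 2
  halve n = n % 2 , n / 2 , ≤-pred (m%n<n n 2) , m≡m%n+[m/n]*n n 2

  2∣m*o⇒2∣m : ∀ {m o} → Odd o → 2 ∣ m * o → 2 ∣ m
  2∣m*o⇒2∣m {m} (t , refl) 2∣m*o = ∣m+n∣m⇒∣n (subst (2 ∣_) (split m t) 2∣m*o) (n∣m*n (m * t))
    where
    split : ∀ m t → m * suc (t * 2) ≡ m * t * 2 + m
    split = solve-∀

  2^k∣m*o⇒2^k∣m : ∀ k {m o} → Odd o → 2 ^ k ∣ m * o → 2 ^ k ∣ m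
  2^k∣m*o⇒2^k∣m zero    odd _ = 1∣ _
  2^k∣m*o⇒2^k∣m (suc k) {m} {o} odd 2^[1+k]∣m*o
    with 2∣m*o⇒2∣m {m} odd (∣-trans (m∣m*n (2 ^ k)) 2^[1+k]∣m*o)
  ... | divides q refl =
    subst (2 ^ suc k ∣_) (*-comm 2 q) (*-monoʳ-∣ 2 (2^k∣m*o⇒2^k∣m k {q} odd 2^k∣q*o))
    where
    2^k∣q*o : 2 ^ k ∣ q * o
    2^k∣q*o = *-cancelˡ-∣ 2 (subst (2 ^ suc k ∣_) (regroup q o) 2^[1+k]∣m*o)
      where
      regroup : ∀ q o → q * 2 * o ≡ 2 * (q * o)
      regroup = solve-∀

  odd∣2^k⇒≡1 : ∀ k {o} → Odd o → o ∣ 2 ^ k → o ≡ 1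
  odd∣2^k⇒≡1 k {o} odd (divides w 2^k≡w*o) with 2^k∣m*o⇒2^k∣m k {w} odd (subst (2 ^ k ∣_) 2^k≡w*o ∣-refl)
  ... | divides v refl = m*n≡1⇒n≡1 v o (*-cancelʳ-≡ (v * o) 1 (2 ^ k) {{m^n≢0 2 k}} (begin
    v * o * 2 ^ k    ≡⟨ swap v o (2 ^ k) ⟩
    v * 2 ^ k * o    ≡⟨ 2^k≡w*o ⟨
    2 ^ k            ≡⟨ *-identityˡ (2 ^ k) ⟨
    1 * 2 ^ k        ∎))
    where
    open ≡-Reasoning
    swap : ∀ v o p → v * o * p ≡ v * p * o
    swap = solve-∀

  ∣2^k⇒≡2^j : ∀ k {d} → d ∣ 2 ^ k → ∃ λ j → d ≡ 2 ^ j
  ∣2^k⇒≡2^j zero    d∣1 = 0 , ∣1⇒≡1 d∣1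
  ∣2^k⇒≡2^j (suc k) {d} d∣2^[1+k] with halve d
  ... | _ , a , s≤s z≤n , refl = 0 , odd∣2^k⇒≡1 (suc k) (a , refl) d∣2^[1+k]
  ... | _ , a , z≤n , refl with ∣2^k⇒≡2^j k {a} (*-cancelˡ-∣ 2 (subst (_∣ 2 ^ suc k) (*-comm a 2) d∣2^[1+k]))
  ...   | j , refl = suc j , *-comm (2 ^ j) 2

  [i+a*2]!≡2^a*a!*odd : ∀ {i} a → i ≤ 1 → ∃ λ o → Odd o × (i + a * 2) ! ≡ 2 ^ a * a ! * o
  [i+a*2]!≡2^a*a!*odd zero z≤n       = 1 , (0 , refl) , refl
  [i+a*2]!≡2^a*a!*odd zero (s≤s z≤n) = 1 , (0 , refl) , refl
  [i+a*2]!≡2^a*a!*odd (suc a) z≤n with [i+a*2]!≡2^a*a!*odd a z≤n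
  ... | o , odd , eq = suc (a * 2) * o , Odd-* (a , refl) odd , (begin
    (2 + a * 2) * ((1 + a * 2) * (a * 2) !)       ≡⟨ cong (λ t → (2 + a * 2) * ((1 + a * 2) * t)) eq ⟩
    (2 + a * 2) * ((1 + a * 2) * (2 ^ a * a ! * o)) ≡⟨ regroup a (2 ^ a) (a !) o ⟩
    2 ^ suc a * suc a ! * (suc (a * 2) * o)       ∎)
    where
    open ≡-Reasoning
    regroup : ∀ a p f o → (2 + a * 2) * ((1 + a * 2) * (p * f * o)) ≡ 2 * p * ((1 + a) * f) * ((1 + a * 2) * o)
    regroup = solve-∀
  [i+a*2]!≡2^a*a!*odd (suc a) (s≤s z≤n) with [i+a*2]!≡2^a*a!*odd a (s≤s z≤n)
  ... | o , odd , eq = suc (suc a * 2) * o , Odd-* (suc a , refl) odd , (begin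
    (3 + a * 2) * ((2 + a * 2) * (1 + a * 2) !)   ≡⟨ cong (λ t → (3 + a * 2) * ((2 + a * 2) * t)) eq ⟩
    (3 + a * 2) * ((2 + a * 2) * (2 ^ a * a ! * o)) ≡⟨ regroup a (2 ^ a) (a !) o ⟩
    2 ^ suc a * suc a ! * (suc (suc a * 2) * o)   ∎)
    where
    open ≡-Reasoning
    regroup : ∀ a p f o → (3 + a * 2) * ((2 + a * 2) * (p * f * o)) ≡ 2 * p * ((1 + a) * f) * ((3 + a * 2) * o)
    regroup = solve-∀

  carry : ∀ {i j c} → i ≤ 1 → j ≤ 1 → c ≤ 1 → ∃₂ λ l c′ → l ≤ 1 × c′ ≤ 1 × i + j + c ≡ l + c′ * 2
  carry {i} {j} {c} i≤1 j≤1 c≤1 =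
    s % 2 , s / 2 , ≤-pred (m%n<n s 2) , /-monoˡ-≤ 2 (+-mono-≤ (+-mono-≤ i≤1 j≤1) c≤1) , m≡m%n+[m/n]*n s 2
    where s = i + j + c

  1<2^[1+m] : ∀ m → 1 < 2 ^ suc m
  1<2^[1+m] m = *-monoʳ-≤ 2 (m^n>0 2 m)

  2^[1+m]∣M!⇒0<M : ∀ M {m} → 2 ^ suc m ∣ M ! → 0 < M
  2^[1+m]∣M!⇒0<M zero    {m} 2^[1+m]∣1 = contradiction (∣1⇒≡1 2^[1+m]∣1) (>⇒≢ (1<2^[1+m] m))
  2^[1+m]∣M!⇒0<M (suc _) _         = z<s

  strip-odd-parts : ∀ x y a b c′ o₁ o₂ o₃ {r n M} →
    r ! ≡ 2 ^ a * a ! * o₁ → n ! ≡ 2 ^ b * b ! * o₂ → M ! ≡ 2 ^ (a + b + c′) * (a + b + c′) ! * o₃ →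
    y * (a ! * b !) ≡ (a + b + c′) ! → x * (r ! * n !) ≡ M ! →
    x * (o₁ * o₂) ≡ 2 ^ c′ * y * o₃
  strip-odd-parts x y a b c′ o₁ o₂ o₃ {r} {n} {M} r!≡ n!≡ M!≡ y≡ x≡ =
    *-cancelʳ-≡ _ _ K {{K≢0}} (begin
      x * (o₁ * o₂) * K                                  ≡⟨ regroupˡ x o₁ o₂ (2 ^ a) (a !) (2 ^ b) (b !) ⟩
      x * (2 ^ a * a ! * o₁ * (2 ^ b * b ! * o₂))        ≡⟨ cong₂ (λ u v → x * (u * v)) r!≡ n!≡ ⟨
      x * (r ! * n !)                                    ≡⟨ x≡ ⟩
      M !                                                ≡⟨ M!≡ ⟩
      2 ^ (a + b + c′) * (a + b + c′) ! * o₃              ≡⟨ cong (λ t → 2 ^ (a + b + c′) * t * o₃) y≡ ⟨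
      2 ^ (a + b + c′) * (y * (a ! * b !)) * o₃           ≡⟨ cong (λ t → t * (y * (a ! * b !)) * o₃) 2^[a+b+c′] ⟩
      2 ^ a * 2 ^ b * 2 ^ c′ * (y * (a ! * b !)) * o₃      ≡⟨ regroupʳ (2 ^ a) (2 ^ b) (2 ^ c′) y (a !) (b !) o₃ ⟩
      2 ^ c′ * y * o₃ * K                                ∎)
    where
    open ≡-Reasoning
    K = 2 ^ a * a ! * (2 ^ b * b !)
    K≢0 : NonZero K
    K≢0 = m*n≢0 _ _ {{m*n≢0 _ _ {{m^n≢0 2 a}} {{a !≢0}}}} {{m*n≢0 _ _ {{m^n≢0 2 b}} {{b !≢0}}}}
    2^[a+b+c′] : 2 ^ (a + b + c′) ≡ 2 ^ a * 2 ^ b * 2 ^ c′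
    2^[a+b+c′] = trans (^-distribˡ-+-* 2 (a + b) c′) (cong (_* 2 ^ c′) (^-distribˡ-+-* 2 a b))
    regroupˡ : ∀ x o₁ o₂ p f q g → x * (o₁ * o₂) * (p * f * (q * g)) ≡ x * (p * f * o₁ * (q * g * o₂))
    regroupˡ = solve-∀
    regroupʳ : ∀ p q s y f g o → p * q * s * (y * (f * g)) * o ≡ s * y * o * (p * f * (q * g))
    regroupʳ = solve-∀

  -- x stands for (r + n + c)! / (r! n!); the exponent is 1 + m because 2^0 ≤ M fails for M = 0.
  V₂Bound : ℕ → Set
  V₂Bound M = ∀ r n c x m → r + n + c ≡ M → c ≤ 1 → x * (r ! * n !) ≡ M ! → 2 ^ suc m ∣ x → 2 ^ suc m ≤ M

  h<l+h*2 : ∀ l {h} → 0 < h → h < l + h * 2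
  h<l+h*2 l {h} 0<h = begin-strict
    h          <⟨ m<m+n h 0<h ⟩
    h + h      ≡⟨ double h ⟩
    h * 2      ≤⟨ m≤n+m (h * 2) l ⟩
    l + h * 2  ∎
    where
    open ≤-Reasoning
    double : ∀ h → h + h ≡ h * 2
    double = solve-∀

  v₂-descend : ∀ {l a b c′ y m} → (∀ {h} → h < l + (a + b + c′) * 2 → V₂Bound h) → c′ ≤ 1 →
               y * (a ! * b !) ≡ (a + b + c′) ! → 2 ^ suc m ∣ 2 ^ c′ * y → 2 ^ suc m ≤ l + (a + b + c′) * 2
  v₂-descend {l} {a} {b} {y = y} {m} rec z≤n y≡ 2^[1+m]∣1*y =
    ≤-trans (rec h<M a b 0 y m refl z≤n y≡ 2^[1+m]∣y) (<⇒≤ h<M)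
    where
    2^[1+m]∣y : 2 ^ suc m ∣ y
    2^[1+m]∣y = subst (2 ^ suc m ∣_) (*-identityˡ y) 2^[1+m]∣1*y
    h<M = h<l+h*2 l (2^[1+m]∣M!⇒0<M (a + b + 0) {m} (∣-trans 2^[1+m]∣y (divides (a ! * b !) (trans (sym y≡) (*-comm y (a ! * b !))))))
  v₂-descend {l} {a} {b} {m = zero} rec (s≤s z≤n) y≡ _ =
    ≤-trans (*-monoˡ-≤ 2 (m≤n+m 1 (a + b))) (m≤n+m _ l)
  v₂-descend {l} {a} {b} {y = y} {suc m} rec (s≤s z≤n) y≡ 2^[2+m]∣2y = begin
    2 * 2 ^ suc m    ≤⟨ *-monoʳ-≤ 2 (rec h<M a b 1 y m refl (s≤s z≤n) y≡ (*-cancelˡ-∣ 2 2^[2+m]∣2y)) ⟩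
    2 * h            ≡⟨ *-comm 2 h ⟩
    h * 2            ≤⟨ m≤n+m (h * 2) l ⟩
    l + h * 2        ∎
    where
    open ≤-Reasoning
    h = a + b + 1
    h<M = h<l+h*2 l (m≤n+m 1 (a + b))

  -- Write r = i + 2a, n = j + 2b and let c′ be the carry of i + j + c, so that M = l + 2(a + b + c′).
  -- Splitting off (i + 2a)! = 2^a a! · odd shows that x is, up to an odd factor, 2^c′ y for the
  -- quotient y = (a + b + c′)! / (a! b!), to which the induction hypothesis applies.
  v₂-bound-step : ∀ M → (∀ {h} → h < M → V₂Bound h) → V₂Bound M
  v₂-bound-step M rec r n c x m M≡ c≤1 x≡ 2^[1+m]∣x with halve r | halve n
  ... | i , a , i≤1 , refl | j , b , j≤1 , refl with carry i≤1 j≤1 c≤1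
  ... | l , c′ , l≤1 , c′≤1 , ijc≡ with [i+a*2]!≡2^a*a!*odd a i≤1 | [i+a*2]!≡2^a*a!*odd b j≤1
                                     | [i+a*2]!≡2^a*a!*odd (a + b + c′) l≤1
  ... | o₁ , _ , r!≡ | o₂ , _ , n!≡ | o₃ , odd₃ , [l+h*2]!≡ with a!b!∣h!
    where
    a!b!∣h! : a ! * b ! ∣ (a + b + c′) !
    a!b!∣h! = ∣-trans (divides ((a + b) C a) (sym ([m+n]Cm*[m!*n!]≡[m+n]! a b))) (m≤n⇒m!∣n! (m≤m+n (a + b) c′))
  ... | divides y h!≡y*a!b! = subst (2 ^ suc m ≤_) (sym M≡l+h*2)
    (v₂-descend {l} {a} {b} {c′} {y} {m} (λ {h} h< → rec (subst (h <_) (sym M≡l+h*2) h<)) c′≤1 (sym h!≡y*a!b!) 2^[1+m]∣2^c′y)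
    where
    open ≡-Reasoning
    M≡l+h*2 : M ≡ l + (a + b + c′) * 2
    M≡l+h*2 = begin
      M                                ≡⟨ M≡ ⟨
      i + a * 2 + (j + b * 2) + c      ≡⟨ collect i j c a b ⟩
      i + j + c + (a + b) * 2          ≡⟨ cong (_+ (a + b) * 2) ijc≡ ⟩
      l + c′ * 2 + (a + b) * 2         ≡⟨ distribute l c′ a b ⟩
      l + (a + b + c′) * 2             ∎
      where
      collect : ∀ i j c a b → i + a * 2 + (j + b * 2) + c ≡ i + j + c + (a + b) * 2
      collect = solve-∀
      distribute : ∀ l c′ a b → l + c′ * 2 + (a + b) * 2 ≡ l + (a + b + c′) * 2
      distribute = solve-∀
    2^[1+m]∣2^c′y : 2 ^ suc m ∣ 2 ^ c′ * y
    2^[1+m]∣2^c′y = 2^k∣m*o⇒2^k∣m (suc m) odd₃ (subst (2 ^ suc m ∣_)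
       (strip-odd-parts x y a b c′ o₁ o₂ o₃ {i + a * 2} {j + b * 2} {M} r!≡ n!≡ (trans (cong _! M≡l+h*2) [l+h*2]!≡) (sym h!≡y*a!b!) x≡) (∣m⇒∣m*n (o₁ * o₂) 2^[1+m]∣x))

  v₂-bound : ∀ M → V₂Bound M
  v₂-bound = <-rec V₂Bound v₂-bound-step

  [m+n]Cm∤2^k : ∀ {m n} → 1 < m → 1 < n → ∀ k → ¬ (m + n) C m ∣ 2 ^ k
  [m+n]Cm∤2^k {m} {n} 1<m 1<n k d∣2^k = <⇒≱ (m+n<[m+n]Cm 1<m 1<n) (d≤m+n (∣2^k⇒≡2^j k d∣2^k))
    where
    d = (m + n) C m
    d≤m+n : ∃ (λ j → d ≡ 2 ^ j) → d ≤ m + n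
    d≤m+n (zero  , d≡1)       = ≤-trans (≤-reflexive d≡1) (≤-trans (<⇒≤ 1<m) (m≤m+n m n))
    d≤m+n (suc j , d≡2^[1+j]) = subst (_≤ m + n) (sym d≡2^[1+j])
      (v₂-bound (m + n) m n 0 d j (+-identityʳ (m + n)) z≤n ([m+n]Cm*[m!*n!]≡[m+n]! m n) (subst (_∣ d) d≡2^[1+j] ∣-refl))

  [1+2n]C[1+n]∤2^k : ∀ n k → 0 < n → ¬ (suc n + n) C suc n ∣ 2 ^ k
  [1+2n]C[1+n]∤2^k n k 0<n C∣2^k with odd∣2^k⇒≡1 k (n , refl) (∣-trans (1+2n∣[1+2n]C[1+n] n) C∣2^k)
  ... | 1+2n≡1 = <⇒≢ (s≤s (≤-trans 0<n (m≤m*n n 2))) (sym 1+2n≡1)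

module RationalSums where

  open import Defs
  open import Data.Nat using (ℕ; zero; suc; _≤_; _<_; _∸_; _^_; z≤n) renaming (_+_ to _+ℕ_; _*_ to _*ℕ_)
  import Data.Nat.Properties as ℕ
  open import Data.Nat.Combinatorics using (_C_; nCk+nC[k+1]≡[n+1]C[k+1]; k>n⇒nCk≡0)
  import Data.Nat.Coprimality as Coprimality
  open import Data.Integer.Base as ℤ using (ℤ; -[1+_]; ∣_∣)
  import Data.Integer.Properties as ℤ
  open import Data.Rational using (ℚ; mkℚ; ↥_; 0ℚ; 1ℚ; _+_; _*_; -_)
  import Data.Rational.Properties as ℚ
  open import Data.Rational.Solver using (module +-*-Solver)
  open import Relation.Binary.PropositionalEquality
  open import Data.Product using (_,_)
  open import Data.Nat.Divisibility using (_∣_; divides)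
  open import Algebra.Bundles using (CommutativeMonoid)
  import Algebra.Properties.CommutativeSemigroup as CommutativeSemigroupProperties
  open BinomialCoefficients using (binomial-revision; 0<[m+n]Cm; [m+n]Cm≡[m+n]Cn; [m+n]Cm≡[n+m]Cn)

  n-coprime-1 : ∀ n → Coprimality.Coprime n 1
  n-coprime-1 n = Coprimality.sym (Coprimality.1-coprimeTo n)

  module ℚ+ = CommutativeSemigroupProperties (CommutativeMonoid.commutativeSemigroup ℚ.+-0-commutativeMonoid)
  module ℚ* = CommutativeSemigroupProperties (CommutativeMonoid.commutativeSemigroup ℚ.*-1-commutativeMonoid)

  ℤ→ℚ≡mkℚ : ∀ z → ℤ→ℚ z ≡ mkℚ z 0 (n-coprime-1 ∣ z ∣)
  ℤ→ℚ≡mkℚ (ℤ.+ n)    = ℚ.normalize-coprime (n-coprime-1 n)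
  ℤ→ℚ≡mkℚ -[1+ n ] = cong -_ (ℚ.normalize-coprime (n-coprime-1 (suc n)))

  ℤ→ℚ-+ : ∀ a b → ℤ→ℚ (a ℤ.+ b) ≡ ℤ→ℚ a + ℤ→ℚ b
  ℤ→ℚ-+ a b rewrite ℤ→ℚ≡mkℚ a | ℤ→ℚ≡mkℚ b | ℤ.*-identityʳ a | ℤ.*-identityʳ b = refl

  ℤ→ℚ-* : ∀ a b → ℤ→ℚ (a ℤ.* b) ≡ ℤ→ℚ a * ℤ→ℚ b
  ℤ→ℚ-* a b rewrite ℤ→ℚ≡mkℚ a | ℤ→ℚ≡mkℚ b = refl

  ℤ→ℚ-injective : ∀ {a b} → ℤ→ℚ a ≡ ℤ→ℚ b → a ≡ b
  ℤ→ℚ-injective {a} {b} eq = cong ↥_ (trans (sym (ℤ→ℚ≡mkℚ a)) (trans eq (ℤ→ℚ≡mkℚ b)))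

  ℕ→ℚ-+ : ∀ m n → ℕ→ℚ (m +ℕ n) ≡ ℕ→ℚ m + ℕ→ℚ n
  ℕ→ℚ-+ m n = trans (cong ℤ→ℚ (ℤ.pos-+ m n)) (ℤ→ℚ-+ (ℤ.+ m) (ℤ.+ n))

  ℕ→ℚ-* : ∀ m n → ℕ→ℚ (m *ℕ n) ≡ ℕ→ℚ m * ℕ→ℚ n
  ℕ→ℚ-* m n = trans (cong ℤ→ℚ (ℤ.pos-* m n)) (ℤ→ℚ-* (ℤ.+ m) (ℤ.+ n))

  ℕ→ℚ-injective : ∀ {m n} → ℕ→ℚ m ≡ ℕ→ℚ n → m ≡ n
  ℕ→ℚ-injective eq = ℤ.+-injective (ℤ→ℚ-injective eq)

  inv*ℕ→ℚ≡1 : ∀ {n} → 0 < n → inv n * ℕ→ℚ n ≡ 1ℚ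
  inv*ℕ→ℚ≡1 {suc n} _ =
    trans (cong₂ _*_ (ℚ.normalize-coprime (Coprimality.1-coprimeTo (suc n))) (ℤ→ℚ≡mkℚ (ℤ.+ suc n)))
          (ℚ.*-inverseˡ (mkℚ (ℤ.+ suc n) 0 (n-coprime-1 (suc n))))

  cross-multiply : ∀ a b d e → a *ℕ d ≡ b *ℕ e → 0 < d → 0 < e → ℕ→ℚ a * inv e ≡ inv d * ℕ→ℚ b
  cross-multiply a b d e ad≡be 0<d 0<e = begin
    ℕ→ℚ a * inv e                         ≡⟨ ℚ.*-identityʳ _ ⟨
    ℕ→ℚ a * inv e * 1ℚ                    ≡⟨ cong (ℕ→ℚ a * inv e *_) (inv*ℕ→ℚ≡1 0<d) ⟨
    ℕ→ℚ a * inv e * (inv d * ℕ→ℚ d)       ≡⟨ wx∙yz≡yx∙wz (ℕ→ℚ a) (inv e) (inv d) (ℕ→ℚ d) ⟩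
    inv d * inv e * (ℕ→ℚ a * ℕ→ℚ d)       ≡⟨ cong (inv d * inv e *_) (trans (sym (ℕ→ℚ-* a d)) (trans (cong ℕ→ℚ ad≡be) (ℕ→ℚ-* b e))) ⟩
    inv d * inv e * (ℕ→ℚ b * ℕ→ℚ e)       ≡⟨ ℚ*.interchange (inv d) (inv e) (ℕ→ℚ b) (ℕ→ℚ e) ⟩
    inv d * ℕ→ℚ b * (inv e * ℕ→ℚ e)       ≡⟨ cong (inv d * ℕ→ℚ b *_) (inv*ℕ→ℚ≡1 0<e) ⟩
    inv d * ℕ→ℚ b * 1ℚ                    ≡⟨ ℚ.*-identityʳ _ ⟩
    inv d * ℕ→ℚ b                         ∎
    where
    open ≡-Reasoning
    open +-*-Solver
    wx∙yz≡yx∙wz : ∀ w x y z → w * x * (y * z) ≡ y * x * (w * z)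
    wx∙yz≡yx∙wz = solve 4 (λ w x y z → w :* x :* (y :* z) := y :* x :* (w :* z)) refl

  sumTo-cong : ∀ n {f g : ℕ → ℚ} → (∀ k → k ≤ n → f k ≡ g k) → sumTo n f ≡ sumTo n g
  sumTo-cong zero    f≗g = f≗g 0 z≤n
  sumTo-cong (suc n) f≗g = cong₂ _+_ (sumTo-cong n (λ k k≤n → f≗g k (ℕ.m≤n⇒m≤1+n k≤n))) (f≗g (suc n) ℕ.≤-refl)

  sumTo-shift : ∀ n (f : ℕ → ℚ) → sumTo (suc n) f ≡ f 0 + sumTo n (λ k → f (suc k))
  sumTo-shift zero    f = refl
  sumTo-shift (suc n) f = trans (cong (_+ f (suc (suc n))) (sumTo-shift n f)) (ℚ.+-assoc (f 0) _ _)

  sumTo-reverse : ∀ n (f : ℕ → ℚ) → sumTo n f ≡ sumTo n (λ k → f (n ∸ k))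
  sumTo-reverse zero    f = refl
  sumTo-reverse (suc n) f = begin
    sumTo n f + f (suc n)                  ≡⟨ ℚ.+-comm (sumTo n f) (f (suc n)) ⟩
    f (suc n) + sumTo n f                  ≡⟨ cong (λ t → f (suc n) + t) (sumTo-reverse n f) ⟩
    f (suc n) + sumTo n (λ k → f (n ∸ k))  ≡⟨ sumTo-shift n (λ k → f (suc n ∸ k)) ⟨
    sumTo (suc n) (λ k → f (suc n ∸ k))    ∎
    where open ≡-Reasoning

  sumTo-split : ∀ m n (f : ℕ → ℚ) → sumTo (m +ℕ n) f + f m ≡ sumTo m f + sumTo n (λ i → f (m +ℕ i))
  sumTo-split m zero    f rewrite ℕ.+-identityʳ m = refl
  sumTo-split m (suc n) f = begin
    sumTo (m +ℕ suc n) f + f m                              ≡⟨ cong (λ t → sumTo t f + f m) (ℕ.+-suc m n) ⟩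
    sumTo (m +ℕ n) f + f (suc (m +ℕ n)) + f m               ≡⟨ ℚ+.xy∙z≈xz∙y (sumTo (m +ℕ n) f) _ _ ⟩
    sumTo (m +ℕ n) f + f m + f (suc (m +ℕ n))               ≡⟨ cong₂ _+_ (sumTo-split m n f) (cong f (sym (ℕ.+-suc m n))) ⟩
    sumTo m f + sumTo n (λ i → f (m +ℕ i)) + f (m +ℕ suc n) ≡⟨ ℚ.+-assoc (sumTo m f) _ _ ⟩
    sumTo m f + sumTo (suc n) (λ i → f (m +ℕ i))            ∎
    where
    open ≡-Reasoning

  sumTo-+ : ∀ n (f g : ℕ → ℚ) → sumTo n (λ k → f k + g k) ≡ sumTo n f + sumTo n g
  sumTo-+ zero    f g = refl
  sumTo-+ (suc n) f g = trans (cong (_+ (f (suc n) + g (suc n))) (sumTo-+ n f g))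
                              (ℚ+.interchange (sumTo n f) (sumTo n g) (f (suc n)) (g (suc n)))

  sumTo-*ˡ : ∀ n c (f : ℕ → ℚ) → c * sumTo n f ≡ sumTo n (λ k → c * f k)
  sumTo-*ˡ zero    c f = refl
  sumTo-*ˡ (suc n) c f = trans (ℚ.*-distribˡ-+ c (sumTo n f) (f (suc n))) (cong (_+ c * f (suc n)) (sumTo-*ˡ n c f))

  sumTo-C≡2^ : ∀ N → sumTo N (λ k → ℕ→ℚ (N C k)) ≡ ℕ→ℚ (2 ^ N)
  sumTo-C≡2^ zero    = refl
  sumTo-C≡2^ (suc N) = begin
    sumTo (suc N) (λ k → ℕ→ℚ (suc N C k))                   ≡⟨ sumTo-shift N (λ k → ℕ→ℚ (suc N C k)) ⟩
    1ℚ + sumTo N (λ k → ℕ→ℚ (suc N C suc k))                ≡⟨ cong (1ℚ +_) (sumTo-cong N pascal) ⟩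
    1ℚ + sumTo N (λ k → ℕ→ℚ (N C k) + ℕ→ℚ (N C suc k))      ≡⟨ cong (1ℚ +_) (sumTo-+ N _ _) ⟩
    1ℚ + (Σ + sumTo N (λ k → ℕ→ℚ (N C suc k)))              ≡⟨ ℚ+.x∙yz≈y∙xz 1ℚ Σ _ ⟩
    Σ + (1ℚ + sumTo N (λ k → ℕ→ℚ (N C suc k)))              ≡⟨ cong (Σ +_) (sumTo-shift N (λ k → ℕ→ℚ (N C k))) ⟨
    Σ + (Σ + ℕ→ℚ (N C suc N))                               ≡⟨ cong (λ t → Σ + (Σ + ℕ→ℚ t)) (k>n⇒nCk≡0 (ℕ.n<1+n N)) ⟩
    Σ + (Σ + 0ℚ)                                            ≡⟨ cong (λ t → t + (t + 0ℚ)) (sumTo-C≡2^ N) ⟩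
    ℕ→ℚ (2 ^ N) + (ℕ→ℚ (2 ^ N) + ℕ→ℚ 0)                     ≡⟨ cong (ℕ→ℚ (2 ^ N) +_) (ℕ→ℚ-+ (2 ^ N) 0) ⟨
    ℕ→ℚ (2 ^ N) + ℕ→ℚ (2 ^ N +ℕ 0)                          ≡⟨ ℕ→ℚ-+ (2 ^ N) (2 ^ N +ℕ 0) ⟨
    ℕ→ℚ (2 ^ suc N)                                         ∎
    where
    open ≡-Reasoning
    Σ = sumTo N (λ k → ℕ→ℚ (N C k))
    pascal : ∀ k → k ≤ N → ℕ→ℚ (suc N C suc k) ≡ ℕ→ℚ (N C k) + ℕ→ℚ (N C suc k)
    pascal k _ = trans (cong ℕ→ℚ (sym (nCk+nC[k+1]≡[n+1]C[k+1] N k))) (ℕ→ℚ-+ (N C k) (N C suc k))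

  partialRowSum : ℕ → ℕ → ℕ
  partialRowSum N zero    = N C 0
  partialRowSum N (suc m) = partialRowSum N m +ℕ N C suc m

  ℕ→ℚ-partialRowSum : ∀ N m → ℕ→ℚ (partialRowSum N m) ≡ sumTo m (λ k → ℕ→ℚ (N C k))
  ℕ→ℚ-partialRowSum N zero    = refl
  ℕ→ℚ-partialRowSum N (suc m) =
    trans (ℕ→ℚ-+ (partialRowSum N m) (N C suc m)) (cong (_+ ℕ→ℚ (N C suc m)) (ℕ→ℚ-partialRowSum N m))

  -- Reflected by C(N, k) = C(N, N ∸ k), the second sum continues the first one past index n, so the two
  -- together cover the row N once, with C(N, n) = C(N, r) counted twice.
  partialRowSum-complement : ∀ r n →
    partialRowSum (r +ℕ n) n +ℕ partialRowSum (r +ℕ n) r ≡ 2 ^ (r +ℕ n) +ℕ (r +ℕ n) C r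
  partialRowSum-complement r n = ℕ→ℚ-injective (begin
    ℕ→ℚ (partialRowSum N n +ℕ partialRowSum N r)          ≡⟨ ℕ→ℚ-+ (partialRowSum N n) (partialRowSum N r) ⟩
    ℕ→ℚ (partialRowSum N n) + ℕ→ℚ (partialRowSum N r)     ≡⟨ cong₂ _+_ (ℕ→ℚ-partialRowSum N n) (ℕ→ℚ-partialRowSum N r) ⟩
    row n + row r                                          ≡⟨ cong (row n +_) (sumTo-reverse r (λ k → ℕ→ℚ (N C k))) ⟩
    row n + sumTo r (λ k → ℕ→ℚ (N C (r ∸ k)))              ≡⟨ cong (row n +_) (sumTo-cong r (λ i i≤r → cong ℕ→ℚ (symmetric i≤r))) ⟩
    row n + sumTo r (λ i → ℕ→ℚ (N C (n +ℕ i)))             ≡⟨ sumTo-split n r (λ k → ℕ→ℚ (N C k)) ⟨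
    sumTo (n +ℕ r) (λ k → ℕ→ℚ (N C k)) + ℕ→ℚ (N C n)      ≡⟨ cong₂ (λ t u → sumTo t (λ k → ℕ→ℚ (N C k)) + ℕ→ℚ u) (ℕ.+-comm n r) (sym ([m+n]Cm≡[m+n]Cn r n)) ⟩
    sumTo N (λ k → ℕ→ℚ (N C k)) + ℕ→ℚ (N C r)            ≡⟨ cong (_+ ℕ→ℚ (N C r)) (sumTo-C≡2^ N) ⟩
    ℕ→ℚ (2 ^ N) + ℕ→ℚ (N C r)                             ≡⟨ ℕ→ℚ-+ (2 ^ N) (N C r) ⟨
    ℕ→ℚ (2 ^ N +ℕ N C r)                                  ∎)
    where
    open ≡-Reasoning
    N = r +ℕ n
    row : ℕ → ℚ
    row m = sumTo m (λ k → ℕ→ℚ (N C k))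
    symmetric : ∀ {i} → i ≤ r → N C (r ∸ i) ≡ N C (n +ℕ i)
    symmetric {i} i≤r = subst (λ t → t C (r ∸ i) ≡ t C (n +ℕ i)) N′≡N ([m+n]Cm≡[m+n]Cn (r ∸ i) (n +ℕ i))
      where
      N′≡N : (r ∸ i) +ℕ (n +ℕ i) ≡ N
      N′≡N = begin
        (r ∸ i) +ℕ (n +ℕ i)   ≡⟨ cong ((r ∸ i) +ℕ_) (ℕ.+-comm n i) ⟩
        (r ∸ i) +ℕ (i +ℕ n)   ≡⟨ ℕ.+-assoc (r ∸ i) i n ⟨
        (r ∸ i) +ℕ i +ℕ n     ≡⟨ cong (_+ℕ n) (ℕ.m∸n+n≡m i≤r) ⟩
        r +ℕ n                ∎

  sgn-+ : ∀ m n → sgn (m +ℕ n) ≡ sgn m * sgn n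
  sgn-+ zero    n = sym (ℚ.*-identityˡ (sgn n))
  sgn-+ (suc m) n = trans (cong (-1ℚ *_) (sgn-+ m n)) (sym (ℚ.*-assoc -1ℚ (sgn m) (sgn n)))

  sgn*sgn≡1 : ∀ n → sgn n * sgn n ≡ 1ℚ
  sgn*sgn≡1 zero    = refl
  sgn*sgn≡1 (suc n) = trans (ℚ*.interchange -1ℚ (sgn n) -1ℚ (sgn n)) (cong ((-1ℚ * -1ℚ) *_) (sgn*sgn≡1 n))

  sgn[n∸k]*sgn[k]≡sgn[n] : ∀ {n k} → k ≤ n → sgn (n ∸ k) * sgn k ≡ sgn n
  sgn[n∸k]*sgn[k]≡sgn[n] {n} {k} k≤n = trans (sym (sgn-+ (n ∸ k) k)) (cong sgn (ℕ.m∸n+n≡m k≤n))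

  -- For n = j + k the revision identity C(n, j) C(r+n, r) = C(r+n, k) C(r+j, r) turns the summand of S
  -- at index j into the k-th summand of the reversed form.
  S-summand-reversed : ∀ r n x {k} → k ≤ n →
    ℕ→ℚ (n C (n ∸ k)) * sgn (n ∸ k) * pow x (n ∸ (n ∸ k)) * inv ((r +ℕ (n ∸ k)) C r)
      ≡ inv ((r +ℕ n) C r) * (ℕ→ℚ ((r +ℕ n) C k) * sgn (n ∸ k) * pow x k)
  S-summand-reversed r n x {k} k≤n with n ∸ k | ℕ.m∸n+n≡m k≤n
  ... | j | refl = begin
    ℕ→ℚ a * sgn j * pow x ((j +ℕ k) ∸ j) * inv e   ≡⟨ cong (λ t → ℕ→ℚ a * sgn j * pow x t * inv e) (ℕ.m+n∸m≡n j k) ⟩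
    ℕ→ℚ a * sgn j * pow x k * inv e                ≡⟨ regroup (ℕ→ℚ a) (sgn j) (pow x k) (inv e) ⟩
    ℕ→ℚ a * inv e * (sgn j * pow x k)              ≡⟨ cong (_* (sgn j * pow x k)) a/e≡b/d ⟩
    inv d * ℕ→ℚ b * (sgn j * pow x k)              ≡⟨ ℚ.*-assoc (inv d) (ℕ→ℚ b) _ ⟩
    inv d * (ℕ→ℚ b * (sgn j * pow x k))            ≡⟨ cong (inv d *_) (ℚ.*-assoc (ℕ→ℚ b) (sgn j) (pow x k)) ⟨
    inv d * (ℕ→ℚ b * sgn j * pow x k)              ∎
    where
    open ≡-Reasoning
    open +-*-Solver
    a = (j +ℕ k) C j
    b = (r +ℕ (j +ℕ k)) C k
    d = (r +ℕ (j +ℕ k)) C r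
    e = (r +ℕ j) C r
    a/e≡b/d : ℕ→ℚ a * inv e ≡ inv d * ℕ→ℚ b
    a/e≡b/d = cross-multiply a b d e (binomial-revision r j k) (0<[m+n]Cm r (j +ℕ k)) (0<[m+n]Cm r j)
    regroup : ∀ a s p e → a * s * p * e ≡ a * e * (s * p)
    regroup = solve 4 (λ a s p e → a :* s :* p :* e := a :* e :* (s :* p)) refl

  S≡reversed : ∀ r n x → S r n x ≡ inv ((r +ℕ n) C r) * sumTo n (λ k → ℕ→ℚ ((r +ℕ n) C k) * sgn (n ∸ k) * pow x k)
  S≡reversed r n x = begin
    S r n x                                                              ≡⟨ sumTo-reverse n _ ⟩
    sumTo n (λ k → ℕ→ℚ (n C (n ∸ k)) * sgn (n ∸ k) * pow x (n ∸ (n ∸ k)) * inv ((r +ℕ (n ∸ k)) C r))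
                                                                         ≡⟨ sumTo-cong n (λ _ → S-summand-reversed r n x) ⟩
    sumTo n (λ k → inv ((r +ℕ n) C r) * term k)
                                                                         ≡⟨ sumTo-*ˡ n (inv ((r +ℕ n) C r)) term ⟨
    inv ((r +ℕ n) C r) * sumTo n term                                    ∎
    where
    open ≡-Reasoning
    term : ℕ → ℚ
    term k = ℕ→ℚ ((r +ℕ n) C k) * sgn (n ∸ k) * pow x k

  S[-1]≡ : ∀ r n → S r n -1ℚ ≡ sgn n * inv ((r +ℕ n) C r) * sumTo n (λ k → ℕ→ℚ ((r +ℕ n) C k))
  S[-1]≡ r n = begin
    S r n -1ℚ                                                     ≡⟨ S≡reversed r n -1ℚ ⟩
    inv c * sumTo n (λ k → ℕ→ℚ (N C k) * sgn (n ∸ k) * sgn k)    ≡⟨ cong (inv c *_) (sumTo-cong n signs) ⟩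
    inv c * sumTo n (λ k → sgn n * ℕ→ℚ (N C k))                  ≡⟨ cong (inv c *_) (sumTo-*ˡ n (sgn n) (λ k → ℕ→ℚ (N C k))) ⟨
    inv c * (sgn n * row)                                         ≡⟨ ℚ*.x∙yz≈yx∙z (inv c) (sgn n) row ⟩
    sgn n * inv c * row                                           ∎
    where
    open ≡-Reasoning
    N = r +ℕ n
    c = N C r
    row = sumTo n (λ k → ℕ→ℚ (N C k))
    signs : ∀ k → k ≤ n → ℕ→ℚ (N C k) * sgn (n ∸ k) * sgn k ≡ sgn n * ℕ→ℚ (N C k)
    signs k k≤n = begin
      ℕ→ℚ (N C k) * sgn (n ∸ k) * sgn k     ≡⟨ ℚ.*-assoc (ℕ→ℚ (N C k)) (sgn (n ∸ k)) (sgn k) ⟩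
      ℕ→ℚ (N C k) * (sgn (n ∸ k) * sgn k)   ≡⟨ cong (ℕ→ℚ (N C k) *_) (sgn[n∸k]*sgn[k]≡sgn[n] k≤n) ⟩
      ℕ→ℚ (N C k) * sgn n                   ≡⟨ ℚ.*-comm (ℕ→ℚ (N C k)) (sgn n) ⟩
      sgn n * ℕ→ℚ (N C k)                   ∎

  sgn*S[-1]≡ : ∀ r n → sgn n * S r n -1ℚ ≡ inv ((r +ℕ n) C r) * ℕ→ℚ (partialRowSum (r +ℕ n) n)
  sgn*S[-1]≡ r n = begin
    sgn n * S r n -1ℚ                ≡⟨ cong (sgn n *_) (S[-1]≡ r n) ⟩
    sgn n * (sgn n * inv c * row)    ≡⟨ cong (sgn n *_) (ℚ.*-assoc (sgn n) (inv c) row) ⟩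
    sgn n * (sgn n * (inv c * row))  ≡⟨ ℚ.*-assoc (sgn n) (sgn n) (inv c * row) ⟨
    sgn n * sgn n * (inv c * row)    ≡⟨ cong (_* (inv c * row)) (sgn*sgn≡1 n) ⟩
    1ℚ * (inv c * row)               ≡⟨ ℚ.*-identityˡ (inv c * row) ⟩
    inv c * row                      ≡⟨ cong (inv c *_) (ℕ→ℚ-partialRowSum (r +ℕ n) n) ⟨
    inv c * ℕ→ℚ (partialRowSum (r +ℕ n) n) ∎
    where
    open ≡-Reasoning
    c = (r +ℕ n) C r
    row = sumTo n (λ k → ℕ→ℚ ((r +ℕ n) C k))

  sgn*S[-1]+sgn*S[-1]≡ : ∀ r n →
    sgn n * S r n -1ℚ + sgn r * S n r -1ℚ ≡ ℕ→ℚ (2 ^ (r +ℕ n)) * inv ((r +ℕ n) C r) + 1ℚ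
  sgn*S[-1]+sgn*S[-1]≡ r n = begin
    sgn n * S r n -1ℚ + sgn r * S n r -1ℚ                       ≡⟨ cong₂ _+_ (sgn*S[-1]≡ r n) (sgn*S[-1]≡ n r) ⟩
    inv c * ℕ→ℚ (A n) + inv ((n +ℕ r) C n) * ℕ→ℚ (partialRowSum (n +ℕ r) r)
                                                                ≡⟨ cong₂ (λ u v → inv c * ℕ→ℚ (A n) + inv u * ℕ→ℚ (partialRowSum v r))
                                                                         ([m+n]Cm≡[n+m]Cn n r) (ℕ.+-comm n r) ⟩
    inv c * ℕ→ℚ (A n) + inv c * ℕ→ℚ (A r)                       ≡⟨ ℚ.*-distribˡ-+ (inv c) _ _ ⟨
    inv c * (ℕ→ℚ (A n) + ℕ→ℚ (A r))                             ≡⟨ cong (inv c *_) (ℕ→ℚ-+ (A n) (A r)) ⟨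
    inv c * ℕ→ℚ (A n +ℕ A r)                                    ≡⟨ cong (λ t → inv c * ℕ→ℚ t) (partialRowSum-complement r n) ⟩
    inv c * ℕ→ℚ (2 ^ (r +ℕ n) +ℕ c)                             ≡⟨ cong (inv c *_) (ℕ→ℚ-+ (2 ^ (r +ℕ n)) c) ⟩
    inv c * (ℕ→ℚ (2 ^ (r +ℕ n)) + ℕ→ℚ c)                        ≡⟨ ℚ.*-distribˡ-+ (inv c) _ _ ⟩
    inv c * ℕ→ℚ (2 ^ (r +ℕ n)) + inv c * ℕ→ℚ c                  ≡⟨ cong₂ _+_ (ℚ.*-comm (inv c) _) (inv*ℕ→ℚ≡1 (0<[m+n]Cm r n)) ⟩
    ℕ→ℚ (2 ^ (r +ℕ n)) * inv c + 1ℚ                             ∎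
    where
    open ≡-Reasoning
    c = (r +ℕ n) C r
    A = partialRowSum (r +ℕ n)

  IsInt-* : ∀ {p q} → IsInt p → IsInt q → IsInt (p * q)
  IsInt-* (a , refl) (b , refl) = a ℤ.* b , sym (ℤ→ℚ-* a b)

  IsInt-sgn : ∀ n → IsInt (sgn n)
  IsInt-sgn zero    = ℤ.+ 1 , refl
  IsInt-sgn (suc n) = IsInt-* (-[1+ 0 ] , refl) (IsInt-sgn n)

  IsInt[inv*ℕ→ℚ]⇒∣ : ∀ {d a} → 0 < d → IsInt (inv d * ℕ→ℚ a) → d ∣ a
  IsInt[inv*ℕ→ℚ]⇒∣ {d} {a} 0<d (z , a/d≡z) =
    divides ∣ z ∣ (trans (cong ∣_∣ (ℤ→ℚ-injective {ℤ.+ a} {z ℤ.* ℤ.+ d} a≡z*d)) (ℤ.abs-* z (ℤ.+ d)))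
    where
    open ≡-Reasoning
    a≡z*d : ℕ→ℚ a ≡ ℤ→ℚ (z ℤ.* ℤ.+ d)
    a≡z*d = begin
      ℕ→ℚ a                       ≡⟨ ℚ.*-identityʳ (ℕ→ℚ a) ⟨
      ℕ→ℚ a * 1ℚ                  ≡⟨ cong (ℕ→ℚ a *_) (inv*ℕ→ℚ≡1 0<d) ⟨
      ℕ→ℚ a * (inv d * ℕ→ℚ d)     ≡⟨ ℚ*.x∙yz≈yx∙z (ℕ→ℚ a) (inv d) (ℕ→ℚ d) ⟩
      inv d * ℕ→ℚ a * ℕ→ℚ d       ≡⟨ cong (_* ℕ→ℚ d) a/d≡z ⟩
      ℤ→ℚ z * ℕ→ℚ d               ≡⟨ ℤ→ℚ-* z (ℤ.+ d) ⟨
      ℤ→ℚ (z ℤ.* ℤ.+ d)           ∎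

  IsInt-S[-1]⇒∣ : ∀ r n → IsInt (S r n -1ℚ) → (r +ℕ n) C r ∣ partialRowSum (r +ℕ n) n
  IsInt-S[-1]⇒∣ r n S∈ℤ =
    IsInt[inv*ℕ→ℚ]⇒∣ (0<[m+n]Cm r n) (subst IsInt (sgn*S[-1]≡ r n) (IsInt-* (IsInt-sgn n) S∈ℤ))

module NonDivisibility where

  open RationalSums using (partialRowSum; partialRowSum-complement)
  open import Data.Nat
  open import Data.Nat.Properties
  open import Data.Nat.Combinatorics using (_C_; nC1≡n)
  open import Data.Nat.Divisibility
  open import Data.Nat.Tactic.RingSolver using (solve-∀)
  open import Data.Product using (_,_)
  open import Data.Sum using (_⊎_; inj₁; inj₂)
  open import Relation.Nullary using (¬_; contradiction; yes; no)
  open import Relation.Binary.PropositionalEquality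
  open BinomialCoefficients using ([m+n]Cm≡[m+n]Cn; [m+n]Cm≡[n+m]Cn)
  open TwoAdic using (odd∣2^k⇒≡1; [m+n]Cm∤2^k; [1+2n]C[1+n]∤2^k)

  0<partialRowSum : ∀ N m → 0 < partialRowSum N m
  0<partialRowSum N zero    = z<s
  0<partialRowSum N (suc m) = ≤-trans (0<partialRowSum N m) (m≤m+n _ _)

  -- d ∣ A = q d with A + A = 2^N + d gives d (2q − 1) = 2^N, and the odd factor 2q − 1 must be 1.
  A+A≡2^N+d⇒d∣A⇒A≡d : ∀ {A d} N → A + A ≡ 2 ^ N + d → d ∣ A → A ≡ d
  A+A≡2^N+d⇒d∣A⇒A≡d {d = d} N 0≡2^N+d (divides zero refl) =
    contradiction 0≡2^N+d (<⇒≢ (≤-trans (m^n>0 2 N) (m≤m+n (2 ^ N) d)))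
  A+A≡2^N+d⇒d∣A⇒A≡d {d = d} N _ (divides (suc zero) refl) = +-identityʳ d
  A+A≡2^N+d⇒d∣A⇒A≡d {d = d} N A+A≡ (divides (suc (suc t)) refl)
    with odd∣2^k⇒≡1 N (suc t , refl) (divides d 2^N≡d*q′)
    where
    2^N≡d*q′ : 2 ^ N ≡ d * suc (suc t * 2)
    2^N≡d*q′ = +-cancelʳ-≡ d (2 ^ N) (d * suc (suc t * 2)) (trans (sym A+A≡) (regroup t d))
      where
      regroup : ∀ t d → suc (suc t) * d + suc (suc t) * d ≡ d * suc (suc t * 2) + d
      regroup = solve-∀
  ... | ()

  [2n]Cn∤partialRowSum : ∀ n → 0 < n → ¬ (n + n) C n ∣ partialRowSum (n + n) n
  [2n]Cn∤partialRowSum n@(suc k) _ d∣A =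
    <⇒≢ (m<n+m d (0<partialRowSum (n + n) k)) (sym (A+A≡2^N+d⇒d∣A⇒A≡d (n + n) (partialRowSum-complement n n) d∣A))
    where d = (n + n) C n

  partialRowSum-half : ∀ n → partialRowSum (suc n + n) n + partialRowSum (suc n + n) n ≡ 2 ^ (suc n + n)
  partialRowSum-half n = +-cancelʳ-≡ d _ _ (begin
    A + A + d       ≡⟨ +-assoc A A d ⟩
    A + (A + d)     ≡⟨ partialRowSum-complement (suc n) n ⟩
    2 ^ N + d       ∎)
    where
    open ≡-Reasoning
    N = suc n + n
    d = N C suc n
    A = partialRowSum N n

  [1+2n]C[1+n]∤partialRowSum : ∀ n → 0 < n → ¬ (suc n + n) C suc n ∣ partialRowSum (suc n + n) n
  [1+2n]C[1+n]∤partialRowSum n 0<n d∣A =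
    [1+2n]C[1+n]∤2^k n (suc n + n) 0<n (subst ((suc n + n) C suc n ∣_) (partialRowSum-half n) (∣m∣n⇒∣m+n d∣A d∣A))

  [2n+1]Cn∤partialRowSum : ∀ n → 0 < n → ¬ (n + suc n) C n ∣ partialRowSum (n + suc n) (suc n)
  [2n+1]Cn∤partialRowSum n 0<n rewrite +-suc n n = λ d′∣A+d →
    [1+2n]C[1+n]∤partialRowSum n 0<n (subst (_∣ A) (sym d≡d′)
      (∣m+n∣m⇒∣n (subst (N C n ∣_) (trans (cong (A +_) d≡d′) (+-comm A (N C n))) d′∣A+d) ∣-refl))
    where
    N = suc n + n
    A = partialRowSum N n
    d≡d′ : N C suc n ≡ N C n
    d≡d′ = [m+n]Cm≡[m+n]Cn (suc n) n

  [n+1]Cn∤partialRowSum : ∀ n → 0 < n → ¬ (n + 1) C n ∣ partialRowSum (n + 1) 1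
  [n+1]Cn∤partialRowSum n 0<n d∣1+d′ = <⇒≢ (+-monoˡ-< 1 0<n) (sym (trans (sym d≡n+1) (∣1⇒≡1 d∣1)))
    where
    d = (n + 1) C n
    d≡n+1 : d ≡ n + 1
    d≡n+1 = trans ([m+n]Cm≡[m+n]Cn n 1) (nC1≡n (n + 1))
    d∣1 : d ∣ 1
    d∣1 = ∣m+n∣m⇒∣n (subst (d ∣_) (trans (cong (1 +_) (sym ([m+n]Cm≡[m+n]Cn n 1))) (+-comm 1 d)) d∣1+d′) ∣-refl

  ∣partialRowSums⇒∣2^[r+n] : ∀ r n → (r + n) C r ∣ partialRowSum (r + n) n → (n + r) C n ∣ partialRowSum (n + r) r →
                             (r + n) C r ∣ 2 ^ (r + n)
  ∣partialRowSums⇒∣2^[r+n] r n d∣Aₙ d′∣A′ᵣ = ∣m+n∣m⇒∣n (subst (d ∣_) Aₙ+Aᵣ≡d+2^N (∣m∣n⇒∣m+n d∣Aₙ d∣Aᵣ)) ∣-refl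
    where
    d = (r + n) C r
    d∣Aᵣ : d ∣ partialRowSum (r + n) r
    d∣Aᵣ = subst₂ (λ e N → e ∣ partialRowSum N r) (sym ([m+n]Cm≡[n+m]Cn r n)) (+-comm n r) d′∣A′ᵣ
    Aₙ+Aᵣ≡d+2^N : partialRowSum (r + n) n + partialRowSum (r + n) r ≡ d + 2 ^ (r + n)
    Aₙ+Aᵣ≡d+2^N = trans (partialRowSum-complement r n) (+-comm (2 ^ (r + n)) d)

  [r+n]Cr∤partialRowSum⊎[n+r]Cn∤partialRowSum : ∀ r n → 0 < r → 0 < n →
    ¬ (r + n) C r ∣ partialRowSum (r + n) n ⊎ ¬ (n + r) C n ∣ partialRowSum (n + r) r
  [r+n]Cr∤partialRowSum⊎[n+r]Cn∤partialRowSum (suc zero) n _ 0<n = inj₂ ([n+1]Cn∤partialRowSum n 0<n)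
  [r+n]Cr∤partialRowSum⊎[n+r]Cn∤partialRowSum r@(suc (suc _)) (suc zero) 0<r _ = inj₁ ([n+1]Cn∤partialRowSum r 0<r)
  [r+n]Cr∤partialRowSum⊎[n+r]Cn∤partialRowSum r@(suc (suc _)) n@(suc (suc _)) _ _
    with (r + n) C r ∣? partialRowSum (r + n) n
  ... | no  d∤Aₙ = inj₁ d∤Aₙ
  ... | yes d∣Aₙ = inj₂ λ d′∣A′ᵣ →
    [m+n]Cm∤2^k {r} {n} (s≤s (s≤s z≤n)) (s≤s (s≤s z≤n)) (r + n) (∣partialRowSums⇒∣2^[r+n] r n d∣Aₙ d′∣A′ᵣ)

open import Defs
open import Data.Nat using (ℕ; _≤_; _∸_; _^_) renaming (_+_ to _+ℕ_)
import Data.Nat.Properties as ℕ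
open import Data.Nat.Combinatorics using (_C_)
open import Data.Rational using (ℚ; 1ℚ; _+_; _*_)
open import Data.Product using (_×_; _,_)
open import Data.Sum using (_⊎_)
import Data.Sum as Sum
open import Function using (_∘_)
open import Relation.Nullary using (¬_)
open import Relation.Binary.PropositionalEquality using (_≡_; subst)
open RationalSums
open NonDivisibility

theorem2p3 : (n r : ℕ) → 1 ≤ n → 1 ≤ r →
    ((x : ℚ) → S r n x ≡ inv ((r +ℕ n) C r) * sumTo n (λ k → ℕ→ℚ ((r +ℕ n) C k) * sgn (n ∸ k) * pow x k))
  × (S r n -1ℚ ≡ sgn n * inv ((r +ℕ n) C r) * sumTo n (λ k → ℕ→ℚ ((r +ℕ n) C k)))
  × (sgn n * S r n -1ℚ + sgn r * S n r -1ℚ ≡ ℕ→ℚ (2 ^ (r +ℕ n)) * inv ((r +ℕ n) C r) + 1ℚ)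
  × ((¬ IsInt (S r n -1ℚ) ⊎ ¬ IsInt (S n r -1ℚ))
    × ¬ IsInt (S n n -1ℚ) × ¬ IsInt (S (n +ℕ 1) n -1ℚ) × ¬ IsInt (S n (n +ℕ 1) -1ℚ))
theorem2p3 n r 0<n 0<r =
    S≡reversed r n
  , S[-1]≡ r n
  , sgn*S[-1]+sgn*S[-1]≡ r n
  , ( Sum.map (_∘ IsInt-S[-1]⇒∣ r n) (_∘ IsInt-S[-1]⇒∣ n r) ([r+n]Cr∤partialRowSum⊎[n+r]Cn∤partialRowSum r n 0<r 0<n)
    , [2n]Cn∤partialRowSum n 0<n ∘ IsInt-S[-1]⇒∣ n n
    , subst (λ m → ¬ IsInt (S m n -1ℚ)) (ℕ.+-comm 1 n) ([1+2n]C[1+n]∤partialRowSum n 0<n ∘ IsInt-S[-1]⇒∣ (1 +ℕ n) n)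
    , subst (λ m → ¬ IsInt (S n m -1ℚ)) (ℕ.+-comm 1 n) ([2n+1]Cn∤partialRowSum n 0<n ∘ IsInt-S[-1]⇒∣ n (1 +ℕ n)) )
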